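{- For every rational $\epsilon\in(0,1)$, there exist regular digraphs with transition matrices $\widetilde{\mathbf{W}},\mathbf{W}$ such that $\widetilde{\mathbf{W}}\approx_\epsilon\mathbf{W}$ and $-\widetilde{\mathbf{W}}\approx_\epsilon-\mathbf{W}$, but $\widetilde{\mathbf{W}}^4\not\approx_c\mathbf{W}^4$ for every finite $c$.
   Context: Digraphs may have parallel edges and self-loops (equivalently, nonnegative integer edge weights). The transition matrix of a digraph with adjacency matrix $\mathbf{A}$ ($\mathbf{A}_{ij}$ = number/weight of edges from $j$ to $i$) and diagonal out-degree matrix $\mathbf{D}$ is $\mathbf{A}\mathbf{D}^{ -1}$. For real matrices, $\widetilde{\mathbf{W}}\approx_\epsilon\mathbf{W}$ (directed spectral approximation) means: for all $x,y\in\mathbb{R}^n$, $|x^\top(\mathbf{W}-\widetilde{\mathbf{W}})y|\le\frac{\epsilon}{2}(\|x\|^2+\|y\|^2-x^\top\mathbf{W}x-y^\top\mathbf{W}y)$.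
   Formalization: In the directed spectral approximation the vectors x, y are taken in ℚ^n rather than ℝ^n, and the finite constant c ranges over the nonnegative rationals. -}

module Defs where

open import Data.Nat as ℕ using (ℕ; zero; suc; NonZero)
open import Data.Fin using (Fin; zero; suc)
open import Data.Integer using (+_)
open import Data.Rational as ℚ using (ℚ; 0ℚ; 1ℚ; _/_; _≤_; ½; ∣_∣)
open import Data.Product using (Σ; ∃; _×_)
open import Relation.Binary.PropositionalEquality using (_≡_)
open import Relation.Nullary using (yes; no)
import Data.Fin

sumℕ : ∀ {n} → (Fin n → ℕ) → ℕ
sumℕ {zero}  f = 0
sumℕ {suc n} f = f zero ℕ.+ sumℕ (λ i → f (suc i))

sumℚ : ∀ {n} → (Fin n → ℚ) → ℚ
sumℚ {zero}  f = 0ℚ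
sumℚ {suc n} f = f zero ℚ.+ sumℚ (λ i → f (suc i))

-- Adjacency matrix of a digraph on n vertices (parallel edges / self-loops
-- allowed): Adj n i j = number of edges from j to i.
Adj : ℕ → Set
Adj n = Fin n → Fin n → ℕ

outdeg : ∀ {n} → Adj n → Fin n → ℕ
outdeg A j = sumℕ (λ i → A i j)

indeg : ∀ {n} → Adj n → Fin n → ℕ
indeg A i = sumℕ (λ j → A i j)

IsRegular : ∀ {n} → Adj n → Set
IsRegular {n} A = ∃ λ d → ((i : Fin n) → indeg A i ≡ d) × ((j : Fin n) → outdeg A j ≡ d)

-- Real matrices are represented by rational matrices
Mat : ℕ → Set
Mat n = Fin n → Fin n → ℚ

Vec : ℕ → Set
Vec n = Fin n → ℚ

-- Transition matrix W = A D^{-1}, i.e. W i j = A i j / outdeg j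
-- (defined when all out-degrees are nonzero).
transition : ∀ {n} (A : Adj n) → ((j : Fin n) → NonZero (outdeg A j)) → Mat n
transition A nz i j = (+ A i j) / outdeg A j
  where instance _ = nz j

_-ᴹ_ : ∀ {n} → Mat n → Mat n → Mat n
(M -ᴹ N) i j = M i j ℚ.- N i j

-ᴹ_ : ∀ {n} → Mat n → Mat n
(-ᴹ M) i j = ℚ.- M i j

_*ᴹ_ : ∀ {n} → Mat n → Mat n → Mat n
(M *ᴹ N) i j = sumℚ (λ k → M i k ℚ.* N k j)

identityᴹ : ∀ {n} → Mat n
identityᴹ i j with i Data.Fin.≟ j
... | yes _ = 1ℚ
... | no  _ = 0ℚ

_^ᴹ_ : ∀ {n} → Mat n → ℕ → Mat n
M ^ᴹ zero  = identityᴹ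
M ^ᴹ suc k = M *ᴹ (M ^ᴹ k)

bilin : ∀ {n} → Vec n → Mat n → Vec n → ℚ
bilin x M y = sumℚ (λ i → sumℚ (λ j → x i ℚ.* M i j ℚ.* y j))

normSq : ∀ {n} → Vec n → ℚ
normSq x = sumℚ (λ i → x i ℚ.* x i)

_≈[_]_ : ∀ {n} → Mat n → ℚ → Mat n → Set
_≈[_]_ {n} W̃ ε W = (x y : Vec n) →
  ∣ bilin x (W -ᴹ W̃) y ∣ ≤
    (ε ℚ.* ½) ℚ.* (normSq x ℚ.+ normSq y ℚ.- bilin x W x ℚ.- bilin y W y)

{-# OPTIONS --safe #-}
-- The lazy, slightly reversed 4-cycle W̃ = (1 - δ) P + δ Pᵀ is compared with the directed
-- 4-cycle P, where δ = 1/(m + 2) ≤ ε/4 (any ε > 0 works); both come from regular digraphs.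
-- P - W̃ = δ (P - Pᵀ) is skew, with xᵀ(P - Pᵀ)y = (x₁ - x₃)(y₀ - y₂) - (x₀ - x₂)(y₁ - y₃), while
-- each gap ‖x‖² ∓ xᵀPx dominates a quarter of (x₀ - x₂)² + (x₁ - x₃)²; AM-GM then gives
-- W̃ ≈_ε P and -W̃ ≈_ε -P. But P⁴ = I makes the right-hand side of W̃⁴ ≈_c P⁴ vanish at
-- x = y = e₀, whereas 1 - (W̃⁴)₀₀ = 4(1 - δ)δ((1 - δ)² + δ²) > 0.
module Submission where

open import Defs
open import Data.Nat using (ℕ; NonZero)
open import Data.Fin using (Fin)
open import Data.Rational using (ℚ; 0ℚ; 1ℚ; _<_; _≤_)
open import Data.Product using (Σ; ∃; _×_)
open import Relation.Nullary using (¬_)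

import Data.Nat as ℕ
import Data.Nat.Properties as ℕ
open import Data.Fin using (zero; suc; _≟_)
import Data.Integer as ℤ
import Data.Integer.Properties as ℤ
open import Data.Integer using (+_; -[1+_])
open import Data.Rational using (mkℚ; ½; ∣_∣; _/_; _+_; _*_; _-_; -_; toℚᵘ; nonNegative; positive)
open import Data.Rational.Properties renaming (_≟_ to _≟ℚ_)
import Data.Rational.Unnormalised as ℚᵘ
import Data.Rational.Unnormalised.Properties as ℚᵘ
open import Data.Product using (_,_; proj₁; proj₂)
open import Data.Sum using (inj₁; inj₂)
open import Function using (_∘_)
open import Relation.Nullary using (yes; no)
open import Relation.Nullary.Decidable using (dec⇒maybe)
open import Relation.Binary.PropositionalEquality
open import Tactic.RingSolver.Core.AlmostCommutativeRing
  using (AlmostCommutativeRing; fromCommutativeRing)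
open import Tactic.RingSolver using (solve-∀)
open import Data.Nat.Tactic.RingSolver renaming (solve-∀ to ℕ-solve-∀)

ℚ-ring : AlmostCommutativeRing _ _
ℚ-ring = fromCommutativeRing +-*-commutativeRing (λ p → dec⇒maybe (0ℚ ≟ℚ p))

0≤* : ∀ {p q} → 0ℚ ≤ p → 0ℚ ≤ q → 0ℚ ≤ p * q
0≤* {p} {q} 0≤p 0≤q =
  nonNegative⁻¹ (p * q) {{nonNeg*nonNeg⇒nonNeg p {{nonNegative 0≤p}} q {{nonNegative 0≤q}}}}

0≤p*p : ∀ p → 0ℚ ≤ p * p
0≤p*p p with ∣p∣≡p∨∣p∣≡-p p
... | inj₁ ∣p∣≡p  = subst (λ r → 0ℚ ≤ r * r) ∣p∣≡p (0≤* (0≤∣p∣ p) (0≤∣p∣ p))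
... | inj₂ ∣p∣≡-p = subst (0ℚ ≤_) (trans (cong₂ _*_ ∣p∣≡-p ∣p∣≡-p) (neg*neg p))
                      (0≤* (0≤∣p∣ p) (0≤∣p∣ p))
  where
  neg*neg : ∀ p → - p * - p ≡ p * p
  neg*neg = solve-∀ ℚ-ring

0≤-⇒≤ : ∀ {p q} → 0ℚ ≤ q - p → p ≤ q
0≤-⇒≤ {p} {q} 0≤q-p = subst₂ _≤_ (+-identityˡ p) (cancel q p) (+-monoˡ-≤ p 0≤q-p)
  where
  cancel : ∀ q p → q - p + p ≡ q
  cancel = solve-∀ ℚ-ring

≤⇒0≤- : ∀ {p q} → p ≤ q → 0ℚ ≤ q - p
≤⇒0≤- {p} {q} p≤q = subst (_≤ q - p) (+-inverseʳ p) (+-monoˡ-≤ (- p) p≤q)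

∣∣≤ : ∀ {p r} → p ≤ r → - p ≤ r → ∣ p ∣ ≤ r
∣∣≤ {p} p≤r -p≤r with ∣p∣≡p∨∣p∣≡-p p
... | inj₁ ∣p∣≡p  = subst (_≤ _) (sym ∣p∣≡p) p≤r
... | inj₂ ∣p∣≡-p = subst (_≤ _) (sym ∣p∣≡-p) -p≤r

0<* : ∀ {p q} → 0ℚ < p → 0ℚ < q → 0ℚ < p * q
0<* {p} {q} 0<p 0<q = positive⁻¹ (p * q) {{pos*pos⇒pos p {{positive 0<p}} q {{positive 0<q}}}}

/-complement : ∀ p q k → p ℕ.+ q ≡ ℕ.suc k → (+ p) / ℕ.suc k ≡ 1ℚ - (+ q) / ℕ.suc k
/-complement p q k p+q≡1+k =
  trans (sym (cancel ((+ p) / ℕ.suc k) ((+ q) / ℕ.suc k))) (cong (_- (+ q) / ℕ.suc k) sum≡1)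
  where
  cancel : ∀ a b → a + b - b ≡ a
  cancel = solve-∀ ℚ-ring
  numerators : ℤ._*_ (+ p ℤ.* + ℕ.suc k ℤ.+ + q ℤ.* + ℕ.suc k) (+ 1) ≡ + 1 ℤ.* + (ℕ.suc k ℕ.* ℕ.suc k)
  numerators = begin
    (+ p ℤ.* + ℕ.suc k ℤ.+ + q ℤ.* + ℕ.suc k) ℤ.* + 1 ≡⟨ ℤ.*-identityʳ _ ⟩
    + p ℤ.* + ℕ.suc k ℤ.+ + q ℤ.* + ℕ.suc k         ≡⟨ ℤ.*-distribʳ-+ (+ ℕ.suc k) (+ p) (+ q) ⟨
    + (p ℕ.+ q) ℤ.* + ℕ.suc k                       ≡⟨ cong (λ d → + d ℤ.* + ℕ.suc k) p+q≡1+k ⟩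
    + ℕ.suc k ℤ.* + ℕ.suc k                         ≡⟨ ℤ.pos-* (ℕ.suc k) (ℕ.suc k) ⟨
    + (ℕ.suc k ℕ.* ℕ.suc k)                         ≡⟨ ℤ.*-identityˡ _ ⟨
    + 1 ℤ.* + (ℕ.suc k ℕ.* ℕ.suc k)                 ∎
    where open ≡-Reasoning
  sum≡1 : (+ p) / ℕ.suc k + (+ q) / ℕ.suc k ≡ 1ℚ
  sum≡1 = toℚᵘ-injective (ℚᵘ.≃-trans (toℚᵘ-homo-+ ((+ p) / ℕ.suc k) ((+ q) / ℕ.suc k))
    (ℚᵘ.≃-trans (ℚᵘ.+-cong (toℚᵘ-fromℚᵘ (ℚᵘ.mkℚᵘ (+ p) k)) (toℚᵘ-fromℚᵘ (ℚᵘ.mkℚᵘ (+ q) k)))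
                (ℚᵘ.*≡* numerators)))

4ℚ : ℚ
4ℚ = + 4 / 1

skew-bound : ∀ {δ ε} a b c d → 0ℚ ≤ δ → 4ℚ * δ ≤ ε →
  ∣ δ * (b * c - a * d) ∣ ≤ ε * ½ * ((a * a + b * b) * (½ * ½) + (c * c + d * d) * (½ * ½))
-- AM-GM: the two slacks are sums of squares, (a ± d)² + (b ∓ c)² absorbing ±2(bc - ad).
skew-bound {δ} {ε} a b c d 0≤δ 4δ≤ε = ∣∣≤
  (0≤-⇒≤ (subst (0ℚ ≤_) (sym (excess₋ δ ε a b c d)) (slack (a + d) (b - c))))
  (0≤-⇒≤ (subst (0ℚ ≤_) (sym (excess₊ δ ε a b c d)) (slack (a - d) (b + c))))
  where
  slack : ∀ u w → 0ℚ ≤ (ε - 4ℚ * δ) * ((a * a + b * b + c * c + d * d) * (½ * ½ * ½))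
                        + δ * ((u * u + w * w) * ½)
  slack u w = +-mono-≤
    (0≤* (≤⇒0≤- 4δ≤ε) (0≤* (+-mono-≤ (+-mono-≤ (+-mono-≤ (0≤p*p a) (0≤p*p b)) (0≤p*p c)) (0≤p*p d))
                          (nonNegative⁻¹ (½ * ½ * ½))))
    (0≤* 0≤δ (0≤* (+-mono-≤ (0≤p*p u) (0≤p*p w)) (nonNegative⁻¹ ½)))
  excess₋ : ∀ δ ε a b c d →
    ε * ½ * ((a * a + b * b) * (½ * ½) + (c * c + d * d) * (½ * ½)) - δ * (b * c - a * d)
    ≡ (ε - 4ℚ * δ) * ((a * a + b * b + c * c + d * d) * (½ * ½ * ½))
      + δ * (((a + d) * (a + d) + (b - c) * (b - c)) * ½)
  excess₋ = solve-∀ ℚ-ring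
  excess₊ : ∀ δ ε a b c d →
    ε * ½ * ((a * a + b * b) * (½ * ½) + (c * c + d * d) * (½ * ½)) - - (δ * (b * c - a * d))
    ≡ (ε - 4ℚ * δ) * ((a * a + b * b + c * c + d * d) * (½ * ½ * ½))
      + δ * (((a - d) * (a - d) + (b + c) * (b + c)) * ½)
  excess₊ = solve-∀ ℚ-ring

sumℚ-cong : ∀ {n} {f g : Fin n → ℚ} → (∀ i → f i ≡ g i) → sumℚ f ≡ sumℚ g
sumℚ-cong {ℕ.zero}  f≗g = refl
sumℚ-cong {ℕ.suc n} f≗g = cong₂ _+_ (f≗g zero) (sumℚ-cong (f≗g ∘ suc))

sumℚ-+ : ∀ {n} (f g : Fin n → ℚ) → sumℚ (λ i → f i + g i) ≡ sumℚ f + sumℚ g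
sumℚ-+ {ℕ.zero}  f g = refl
sumℚ-+ {ℕ.suc n} f g = trans (cong (_+_ (f zero + g zero)) (sumℚ-+ (f ∘ suc) (g ∘ suc)))
                             (+-interchange (f zero) (g zero) (sumℚ (f ∘ suc)) (sumℚ (g ∘ suc)))
  where
  +-interchange : ∀ a b c d → a + b + (c + d) ≡ a + c + (b + d)
  +-interchange = solve-∀ ℚ-ring

sumℚ-neg : ∀ {n} (f : Fin n → ℚ) → sumℚ (λ i → - f i) ≡ - sumℚ f
sumℚ-neg {ℕ.zero}  f = refl
sumℚ-neg {ℕ.suc n} f = trans (cong (_+_ (- f zero)) (sumℚ-neg (f ∘ suc)))
                             (sym (neg-distrib-+ (f zero) (sumℚ (f ∘ suc))))

sumℚ-sub : ∀ {n} (f g : Fin n → ℚ) → sumℚ (λ i → f i - g i) ≡ sumℚ f - sumℚ g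
sumℚ-sub f g = trans (sumℚ-+ f (λ i → - g i)) (cong (_+_ (sumℚ f)) (sumℚ-neg g))

sumℚ-*ˡ : ∀ {n} c (f : Fin n → ℚ) → sumℚ (λ i → c * f i) ≡ c * sumℚ f
sumℚ-*ˡ {ℕ.zero}  c f = sym (*-zeroʳ c)
sumℚ-*ˡ {ℕ.suc n} c f = trans (cong (_+_ (c * f zero)) (sumℚ-*ˡ c (f ∘ suc)))
                              (sym (*-distribˡ-+ c (f zero) (sumℚ (f ∘ suc))))

identityᴹ-suc : ∀ {n} (i j : Fin n) → identityᴹ {ℕ.suc n} (suc i) (suc j) ≡ identityᴹ i j
identityᴹ-suc i j with i ≟ j
... | yes _ = refl
... | no _  = refl

sumℚ-identityˡ : ∀ {n} k (f : Fin n → ℚ) → sumℚ (λ j → identityᴹ k j * f j) ≡ f k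
sumℚ-identityˡ zero f =
  trans (cong₂ _+_ (*-identityˡ (f zero)) (trans (sumℚ-*ˡ 0ℚ (f ∘ suc)) (*-zeroˡ (sumℚ (f ∘ suc)))))
        (+-identityʳ (f zero))
sumℚ-identityˡ (suc k) f =
  trans (cong₂ _+_ (*-zeroˡ (f zero))
                   (trans (sumℚ-cong (λ j → cong (_* f (suc j)) (identityᴹ-suc k j)))
                          (sumℚ-identityˡ k (f ∘ suc))))
        (+-identityˡ (f (suc k)))

sumℚ-identityʳ : ∀ {n} k (f : Fin n → ℚ) → sumℚ (λ j → f j * identityᴹ k j) ≡ f k
sumℚ-identityʳ k f = trans (sumℚ-cong (λ j → *-comm (f j) (identityᴹ k j))) (sumℚ-identityˡ k f)

dot : ∀ {n} → Vec n → Vec n → ℚ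
dot x y = sumℚ (λ i → x i * y i)

dot-linear : ∀ {n} (x : Vec n) a b u w →
             dot x (λ i → a * u i + b * w i) ≡ a * dot x u + b * dot x w
dot-linear x a b u w = begin
  dot x (λ i → a * u i + b * w i)
    ≡⟨ sumℚ-cong (λ i → distrib (x i) a b (u i) (w i)) ⟩
  sumℚ (λ i → a * (x i * u i) + b * (x i * w i))
    ≡⟨ sumℚ-+ (λ i → a * (x i * u i)) (λ i → b * (x i * w i)) ⟩
  sumℚ (λ i → a * (x i * u i)) + sumℚ (λ i → b * (x i * w i))
    ≡⟨ cong₂ _+_ (sumℚ-*ˡ a (λ i → x i * u i)) (sumℚ-*ˡ b (λ i → x i * w i)) ⟩
  a * dot x u + b * dot x w
    ∎
  where
  open ≡-Reasoning
  distrib : ∀ x a b u w → x * (a * u + b * w) ≡ a * (x * u) + b * (x * w)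
  distrib = solve-∀ ℚ-ring

0≤normSq : ∀ {n} (x : Vec n) → 0ℚ ≤ normSq x
0≤normSq {ℕ.zero}  x = ≤-refl
0≤normSq {ℕ.suc n} x = +-mono-≤ (0≤p*p (x zero)) (0≤normSq (x ∘ suc))

_·ᵛ_ : ∀ {n} → Mat n → Vec n → Vec n
(M ·ᵛ v) i = sumℚ (λ j → M i j * v j)

_≗ᴹ_ : ∀ {n} → Mat n → Mat n → Set
M ≗ᴹ N = ∀ i j → M i j ≡ N i j

≗ᴹ-sym : ∀ {n} {M N : Mat n} → M ≗ᴹ N → N ≗ᴹ M
≗ᴹ-sym M≗N i j = sym (M≗N i j)

-ᴹ-cong : ∀ {n} {M N : Mat n} → M ≗ᴹ N → (-ᴹ M) ≗ᴹ (-ᴹ N)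
-ᴹ-cong M≗N i j = cong -_ (M≗N i j)

^ᴹ-cong : ∀ {n} {M N : Mat n} → M ≗ᴹ N → ∀ k → (M ^ᴹ k) ≗ᴹ (N ^ᴹ k)
^ᴹ-cong M≗N ℕ.zero    i j = refl
^ᴹ-cong M≗N (ℕ.suc k) i j = sumℚ-cong (λ l → cong₂ _*_ (M≗N i l) (^ᴹ-cong M≗N k l j))

bilin-cong : ∀ {n} (x : Vec n) {M N : Mat n} y → M ≗ᴹ N → bilin x M y ≡ bilin x N y
bilin-cong x y M≗N = sumℚ-cong (λ i → sumℚ-cong (λ j → cong (λ m → x i * m * y j) (M≗N i j)))

bilin-·ᵛ : ∀ {n} (x : Vec n) M y → bilin x M y ≡ dot x (M ·ᵛ y)
bilin-·ᵛ x M y = sumℚ-cong (λ i →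
  trans (sumℚ-cong (λ j → *-assoc (x i) (M i j) (y j))) (sumℚ-*ˡ (x i) (λ j → M i j * y j)))

bilin-identity : ∀ {n} i (M : Mat n) j → bilin (identityᴹ i) M (identityᴹ j) ≡ M i j
bilin-identity i M j = begin
  bilin (identityᴹ i) M (identityᴹ j)    ≡⟨ bilin-·ᵛ (identityᴹ i) M (identityᴹ j) ⟩
  dot (identityᴹ i) (M ·ᵛ identityᴹ j)   ≡⟨ sumℚ-identityˡ i (M ·ᵛ identityᴹ j) ⟩
  (M ·ᵛ identityᴹ j) i                  ≡⟨ sumℚ-identityʳ j (M i) ⟩
  M i j                                 ∎
  where open ≡-Reasoning

bilin-sub : ∀ {n} (x : Vec n) M N y → bilin x (M -ᴹ N) y ≡ bilin x M y - bilin x N y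
bilin-sub x M N y = trans
  (sumℚ-cong (λ i → trans (sumℚ-cong (λ j → distrib (x i) (M i j) (N i j) (y j)))
                          (sumℚ-sub (λ j → x i * M i j * y j) (λ j → x i * N i j * y j))))
  (sumℚ-sub (λ i → sumℚ (λ j → x i * M i j * y j)) (λ i → sumℚ (λ j → x i * N i j * y j)))
  where
  distrib : ∀ a m n b → a * (m - n) * b ≡ a * m * b - a * n * b
  distrib = solve-∀ ℚ-ring

bilin-neg : ∀ {n} (x : Vec n) M y → bilin x (-ᴹ M) y ≡ - bilin x M y
bilin-neg x M y = trans
  (sumℚ-cong (λ i → trans (sumℚ-cong (λ j → distrib (x i) (M i j) (y j)))
                          (sumℚ-neg (λ j → x i * M i j * y j))))
  (sumℚ-neg (λ i → sumℚ (λ j → x i * M i j * y j)))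
  where
  distrib : ∀ a m b → a * (- m) * b ≡ - (a * m * b)
  distrib = solve-∀ ℚ-ring

gap : ∀ {n} → Mat n → Vec n → ℚ
gap W x = normSq x - bilin x W x

gap-split : ∀ {n} (W : Mat n) x y →
            normSq x + normSq y - bilin x W x - bilin y W y ≡ gap W x + gap W y
gap-split W x y = regroup (normSq x) (normSq y) (bilin x W x) (bilin y W y)
  where
  regroup : ∀ a b c d → a + b - c - d ≡ (a - c) + (b - d)
  regroup = solve-∀ ℚ-ring

≈-intro : ∀ {n} {W̃ W : Mat n} {ε} (q : Vec n → ℚ) → 0ℚ ≤ ε →
          (∀ x → q x ≤ gap W x) →
          (∀ x y → ∣ bilin x (W -ᴹ W̃) y ∣ ≤ ε * ½ * (q x + q y)) →
          W̃ ≈[ ε ] W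
≈-intro {W̃ = W̃} {W} {ε} q 0≤ε q≤gap bound x y = begin
  ∣ bilin x (W -ᴹ W̃) y ∣        ≤⟨ bound x y ⟩
  ε * ½ * (q x + q y)          ≤⟨ *-monoˡ-≤-nonNeg (ε * ½) {{nonNegative 0≤ε/2}}
                                    (+-mono-≤ (q≤gap x) (q≤gap y)) ⟩
  ε * ½ * (gap W x + gap W y)  ≡⟨ cong (ε * ½ *_) (gap-split W x y) ⟨
  ε * ½ * (normSq x + normSq y - bilin x W x - bilin y W y) ∎
  where
  open ≤-Reasoning
  0≤ε/2 : 0ℚ ≤ ε * ½
  0≤ε/2 = 0≤* 0≤ε (nonNegative⁻¹ ½)

≈⇒defect≡0 : ∀ {n} {W̃ W : Mat n} {c} x → W̃ ≈[ c ] W → gap W x ≡ 0ℚ →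
             bilin x (W -ᴹ W̃) x ≡ 0ℚ
≈⇒defect≡0 {W = W} {c} x approx gap≡0 =
  ∣p∣≡0⇒p≡0 _ (≤-antisym (subst (∣ _ ∣ ≤_) bound≡0 (approx x x)) (0≤∣p∣ _))
  where
  open ≡-Reasoning
  bound≡0 : c * ½ * (normSq x + normSq x - bilin x W x - bilin x W x) ≡ 0ℚ
  bound≡0 = begin
    c * ½ * (normSq x + normSq x - bilin x W x - bilin x W x) ≡⟨ cong (c * ½ *_) (gap-split W x x) ⟩
    c * ½ * (gap W x + gap W x)                               ≡⟨ cong (λ g → c * ½ * (g + g)) gap≡0 ⟩
    c * ½ * 0ℚ                                                ≡⟨ *-zeroʳ (c * ½) ⟩
    0ℚ                                                        ∎

≈-resp : ∀ {n} {W̃ W̃′ W W′ : Mat n} {ε} → W̃ ≗ᴹ W̃′ → W ≗ᴹ W′ → W̃ ≈[ ε ] W → W̃′ ≈[ ε ] W′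
≈-resp {ε = ε} W̃≗W̃′ W≗W′ approx x y = subst₂ (λ d g → ∣ d ∣ ≤ ε * ½ * g)
  (bilin-cong x y (λ i j → cong₂ _-_ (W≗W′ i j) (W̃≗W̃′ i j)))
  (cong₂ _-_ (cong (λ b → normSq x + normSq y - b) (bilin-cong x x W≗W′)) (bilin-cong y y W≗W′))
  (approx x y)

pattern 0F = zero
pattern 1F = suc zero
pattern 2F = suc (suc zero)
pattern 3F = suc (suc (suc zero))

next prev : Fin 4 → Fin 4
next 0F = 1F
next 1F = 2F
next 2F = 3F
next 3F = 0F
prev 0F = 3F
prev 1F = 0F
prev 2F = 1F
prev 3F = 2F

next∘prev : ∀ i → next (prev i) ≡ i
next∘prev 0F = refl
next∘prev 1F = refl
next∘prev 2F = refl
next∘prev 3F = refl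

prev∘next : ∀ i → prev (next i) ≡ i
prev∘next 0F = refl
prev∘next 1F = refl
prev∘next 2F = refl
prev∘next 3F = refl

prev∘prev : ∀ i → prev (prev i) ≡ next (next i)
prev∘prev 0F = refl
prev∘prev 1F = refl
prev∘prev 2F = refl
prev∘prev 3F = refl

-- Entry (i , j) weights the edge j → i: a on the cycle edges j → next j,
-- b on the reversed edges j → prev j, z elsewhere.
cyclic : {A : Set} → A → A → A → Fin 4 → Fin 4 → A
cyclic z a b i j with prev i ≟ j | next i ≟ j
... | yes _ | _     = a
... | no _  | yes _ = b
... | no _  | no _  = z

cyclic-map : ∀ {A B : Set} (f : A → B) z a b i j →
             f (cyclic z a b i j) ≡ cyclic (f z) (f a) (f b) i j
cyclic-map f z a b i j with prev i ≟ j | next i ≟ j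
... | yes _ | _     = refl
... | no _  | yes _ = refl
... | no _  | no _  = refl

cycleAdj : ℕ → ℕ → Adj 4
cycleAdj = cyclic 0

cycleᴹ : ℚ → ℚ → Mat 4
cycleᴹ = cyclic 0ℚ

private
  p+[q+0]≡p+q : ∀ p q → p ℕ.+ (q ℕ.+ 0) ≡ p ℕ.+ q
  p+[q+0]≡p+q p q = cong (p ℕ.+_) (ℕ.+-identityʳ q)

  q+[p+0]≡p+q : ∀ p q → q ℕ.+ (p ℕ.+ 0) ≡ p ℕ.+ q
  q+[p+0]≡p+q p q = trans (p+[q+0]≡p+q q p) (ℕ.+-comm q p)

cycleAdj-indeg : ∀ p q i → indeg (cycleAdj p q) i ≡ p ℕ.+ q
cycleAdj-indeg p q 0F = q+[p+0]≡p+q p q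
cycleAdj-indeg p q 1F = p+[q+0]≡p+q p q
cycleAdj-indeg p q 2F = p+[q+0]≡p+q p q
cycleAdj-indeg p q 3F = q+[p+0]≡p+q p q

cycleAdj-outdeg : ∀ p q j → outdeg (cycleAdj p q) j ≡ p ℕ.+ q
cycleAdj-outdeg p q 0F = p+[q+0]≡p+q p q
cycleAdj-outdeg p q 1F = q+[p+0]≡p+q p q
cycleAdj-outdeg p q 2F = q+[p+0]≡p+q p q
cycleAdj-outdeg p q 3F = p+[q+0]≡p+q p q

cycleAdj-regular : ∀ p q → IsRegular (cycleAdj p q)
cycleAdj-regular p q = p ℕ.+ q , cycleAdj-indeg p q , cycleAdj-outdeg p q

cycleAdj-nonZero : ∀ p q {{_ : NonZero (p ℕ.+ q)}} j → NonZero (outdeg (cycleAdj p q) j)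
cycleAdj-nonZero p q {{p+q≢0}} j = subst NonZero (sym (cycleAdj-outdeg p q j)) p+q≢0

transition-regular : ∀ {n} (A : Adj n) nz {d} .{{_ : NonZero d}} → (∀ j → outdeg A j ≡ d) →
                     ∀ i j → transition A nz i j ≡ (+ A i j) / d
transition-regular A nz deg i j = /-cong {+ A i j} {{nz j}} refl (deg j)

transition-cycleAdj : ∀ p q .{{_ : NonZero (p ℕ.+ q)}} nz →
  transition (cycleAdj p q) nz ≗ᴹ cycleᴹ ((+ p) / (p ℕ.+ q)) ((+ q) / (p ℕ.+ q))
transition-cycleAdj p q nz i j = begin
  transition (cycleAdj p q) nz i j
    ≡⟨ transition-regular (cycleAdj p q) nz (cycleAdj-outdeg p q) i j ⟩
  (+ cycleAdj p q i j) / (p ℕ.+ q)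
    ≡⟨ cyclic-map (λ k → (+ k) / (p ℕ.+ q)) 0 p q i j ⟩
  cyclic ((+ 0) / (p ℕ.+ q)) ((+ p) / (p ℕ.+ q)) ((+ q) / (p ℕ.+ q)) i j
    ≡⟨ cong (λ z → cyclic z ((+ p) / (p ℕ.+ q)) ((+ q) / (p ℕ.+ q)) i j) (0/n≡0 (p ℕ.+ q)) ⟩
  cycleᴹ ((+ p) / (p ℕ.+ q)) ((+ q) / (p ℕ.+ q)) i j
    ∎
  where open ≡-Reasoning

cycleᴹ-·ᵛ : ∀ a b v i → (cycleᴹ a b ·ᵛ v) i ≡ a * v (prev i) + b * v (next i)
cycleᴹ-·ᵛ a b v = rows
  where
  even-row : ∀ p q u₀ u₁ u₂ u₃ → 0ℚ * u₀ + (p * u₁ + (0ℚ * u₂ + (q * u₃ + 0ℚ))) ≡ p * u₁ + q * u₃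
  even-row = solve-∀ ℚ-ring
  odd-row : ∀ p q u₀ u₁ u₂ u₃ → p * u₀ + (0ℚ * u₁ + (q * u₂ + (0ℚ * u₃ + 0ℚ))) ≡ p * u₀ + q * u₂
  odd-row = solve-∀ ℚ-ring
  rows : ∀ i → (cycleᴹ a b ·ᵛ v) i ≡ a * v (prev i) + b * v (next i)
  rows 0F = trans (even-row b a (v 0F) (v 1F) (v 2F) (v 3F)) (+-comm (b * v 1F) (a * v 3F))
  rows 1F = odd-row a b (v 0F) (v 1F) (v 2F) (v 3F)
  rows 2F = even-row a b (v 0F) (v 1F) (v 2F) (v 3F)
  rows 3F = trans (odd-row b a (v 0F) (v 1F) (v 2F) (v 3F)) (+-comm (b * v 0F) (a * v 2F))

bilin-cycleᴹ : ∀ a b x y → bilin x (cycleᴹ a b) y ≡ a * dot x (y ∘ prev) + b * dot x (y ∘ next)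
bilin-cycleᴹ a b x y = begin
  bilin x (cycleᴹ a b) y
    ≡⟨ bilin-·ᵛ x (cycleᴹ a b) y ⟩
  dot x (cycleᴹ a b ·ᵛ y)
    ≡⟨ sumℚ-cong (λ i → cong (x i *_) (cycleᴹ-·ᵛ a b y i)) ⟩
  dot x (λ i → a * y (prev i) + b * y (next i))
    ≡⟨ dot-linear x a b (y ∘ prev) (y ∘ next) ⟩
  a * dot x (y ∘ prev) + b * dot x (y ∘ next)
    ∎
  where open ≡-Reasoning

cycleᴹ-^-suc : ∀ a b k i j → (cycleᴹ a b ^ᴹ ℕ.suc k) i j ≡
               a * (cycleᴹ a b ^ᴹ k) (prev i) j + b * (cycleᴹ a b ^ᴹ k) (next i) j
cycleᴹ-^-suc a b k i j = cycleᴹ-·ᵛ a b (λ l → (cycleᴹ a b ^ᴹ k) l j) i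

-- Two steps of the walk: P² = P⁻² on the 4-cycle, so W² = 2ab I + (a² + b²) P².
cycleᴹ-^-2+ : ∀ a b k i j → (cycleᴹ a b ^ᴹ (2 ℕ.+ k)) i j ≡
  (a * b + a * b) * (cycleᴹ a b ^ᴹ k) i j + (a * a + b * b) * (cycleᴹ a b ^ᴹ k) (next (next i)) j
cycleᴹ-^-2+ a b k i j = begin
  (cycleᴹ a b ^ᴹ (2 ℕ.+ k)) i j
    ≡⟨ cycleᴹ-^-suc a b (ℕ.suc k) i j ⟩
  a * (cycleᴹ a b ^ᴹ ℕ.suc k) (prev i) j + b * (cycleᴹ a b ^ᴹ ℕ.suc k) (next i) j
    ≡⟨ cong₂ (λ u w → a * u + b * w) (cycleᴹ-^-suc a b k (prev i) j) (cycleᴹ-^-suc a b k (next i) j) ⟩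
  a * (a * M (prev (prev i)) + b * M (next (prev i)))
    + b * (a * M (prev (next i)) + b * M (next (next i)))
    ≡⟨ reindex ⟩
  a * (a * M (next (next i)) + b * M i) + b * (a * M i + b * M (next (next i)))
    ≡⟨ two-steps a b (M i) (M (next (next i))) ⟩
  (a * b + a * b) * M i + (a * a + b * b) * M (next (next i))
    ∎
  where
  open ≡-Reasoning
  M : Vec 4
  M l = (cycleᴹ a b ^ᴹ k) l j
  reindex : a * (a * M (prev (prev i)) + b * M (next (prev i)))
            + b * (a * M (prev (next i)) + b * M (next (next i)))
          ≡ a * (a * M (next (next i)) + b * M i) + b * (a * M i + b * M (next (next i)))
  reindex rewrite prev∘prev i | next∘prev i | prev∘next i = refl
  two-steps : ∀ a b u w → a * (a * w + b * u) + b * (a * u + b * w)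
                          ≡ (a * b + a * b) * u + (a * a + b * b) * w
  two-steps = solve-∀ ℚ-ring

antipodal : Vec 4 → ℚ
antipodal x = ((x 0F - x 2F) * (x 0F - x 2F) + (x 1F - x 3F) * (x 1F - x 3F)) * (½ * ½)

cycle-skew : ∀ δ x y → bilin x (cycleᴹ 1ℚ 0ℚ -ᴹ cycleᴹ (1ℚ - δ) δ) y ≡
             δ * ((x 1F - x 3F) * (y 0F - y 2F) - (x 0F - x 2F) * (y 1F - y 3F))
cycle-skew δ x y = begin
  bilin x (cycleᴹ 1ℚ 0ℚ -ᴹ cycleᴹ (1ℚ - δ) δ) y
    ≡⟨ bilin-sub x (cycleᴹ 1ℚ 0ℚ) (cycleᴹ (1ℚ - δ) δ) y ⟩
  bilin x (cycleᴹ 1ℚ 0ℚ) y - bilin x (cycleᴹ (1ℚ - δ) δ) y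
    ≡⟨ cong₂ _-_ (bilin-cycleᴹ 1ℚ 0ℚ x y) (bilin-cycleᴹ (1ℚ - δ) δ x y) ⟩
  (1ℚ * dot x (y ∘ prev) + 0ℚ * dot x (y ∘ next)) - ((1ℚ - δ) * dot x (y ∘ prev) + δ * dot x (y ∘ next))
    ≡⟨ skew δ (x 0F) (x 1F) (x 2F) (x 3F) (y 0F) (y 1F) (y 2F) (y 3F) ⟩
  δ * ((x 1F - x 3F) * (y 0F - y 2F) - (x 0F - x 2F) * (y 1F - y 3F))
    ∎
  where
  open ≡-Reasoning
  skew : ∀ δ x₀ x₁ x₂ x₃ y₀ y₁ y₂ y₃ →
    let forward  = x₀ * y₃ + (x₁ * y₀ + (x₂ * y₁ + (x₃ * y₂ + 0ℚ)))
        backward = x₀ * y₁ + (x₁ * y₂ + (x₂ * y₃ + (x₃ * y₀ + 0ℚ)))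
    in (1ℚ * forward + 0ℚ * backward) - ((1ℚ - δ) * forward + δ * backward)
       ≡ δ * ((x₁ - x₃) * (y₀ - y₂) - (x₀ - x₂) * (y₁ - y₃))
  skew = solve-∀ ℚ-ring

cycle-skew-bound : ∀ {δ ε} → 0ℚ ≤ δ → 4ℚ * δ ≤ ε → ∀ x y →
  ∣ bilin x (cycleᴹ 1ℚ 0ℚ -ᴹ cycleᴹ (1ℚ - δ) δ) y ∣ ≤ ε * ½ * (antipodal x + antipodal y)
cycle-skew-bound {δ} 0≤δ 4δ≤ε x y = subst (λ t → ∣ t ∣ ≤ _) (sym (cycle-skew δ x y))
  (skew-bound (x 0F - x 2F) (x 1F - x 3F) (y 0F - y 2F) (y 1F - y 3F) 0≤δ 4δ≤ε)

-- The gap exceeds the antipodal term by a sum of squared second differences.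
cycle-gap : ∀ x → antipodal x ≤ gap (cycleᴹ 1ℚ 0ℚ) x
cycle-gap x =
  0≤-⇒≤ (subst (0ℚ ≤_) (sym excess) (0≤* (0≤normSq curvature) (nonNegative⁻¹ (½ * ½ * ½))))
  where
  curvature : Vec 4
  curvature i = x (prev i) - (x i + x i) + x (next i)
  identity : ∀ x₀ x₁ x₂ x₃ →
    let norm     = x₀ * x₀ + (x₁ * x₁ + (x₂ * x₂ + (x₃ * x₃ + 0ℚ)))
        forward  = x₀ * x₃ + (x₁ * x₀ + (x₂ * x₁ + (x₃ * x₂ + 0ℚ)))
        backward = x₀ * x₁ + (x₁ * x₂ + (x₂ * x₃ + (x₃ * x₀ + 0ℚ)))
        c₀ = x₃ - (x₀ + x₀) + x₁
        c₁ = x₀ - (x₁ + x₁) + x₂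
        c₂ = x₁ - (x₂ + x₂) + x₃
        c₃ = x₂ - (x₃ + x₃) + x₀
    in norm - (1ℚ * forward + 0ℚ * backward)
         - ((x₀ - x₂) * (x₀ - x₂) + (x₁ - x₃) * (x₁ - x₃)) * (½ * ½)
       ≡ (c₀ * c₀ + (c₁ * c₁ + (c₂ * c₂ + (c₃ * c₃ + 0ℚ)))) * (½ * ½ * ½)
  identity = solve-∀ ℚ-ring
  excess : gap (cycleᴹ 1ℚ 0ℚ) x - antipodal x ≡ normSq curvature * (½ * ½ * ½)
  excess = trans (cong (λ b → normSq x - b - antipodal x) (bilin-cycleᴹ 1ℚ 0ℚ x x))
                 (identity (x 0F) (x 1F) (x 2F) (x 3F))

neg-cycle-gap : ∀ x → antipodal x ≤ gap (-ᴹ cycleᴹ 1ℚ 0ℚ) x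
neg-cycle-gap x =
  0≤-⇒≤ (subst (0ℚ ≤_) (sym excess) (0≤* (0≤normSq curvature) (nonNegative⁻¹ (½ * ½ * ½))))
  where
  curvature : Vec 4
  curvature i = x (prev i) + (x i + x i) + x (next i)
  identity : ∀ x₀ x₁ x₂ x₃ →
    let norm     = x₀ * x₀ + (x₁ * x₁ + (x₂ * x₂ + (x₃ * x₃ + 0ℚ)))
        forward  = x₀ * x₃ + (x₁ * x₀ + (x₂ * x₁ + (x₃ * x₂ + 0ℚ)))
        backward = x₀ * x₁ + (x₁ * x₂ + (x₂ * x₃ + (x₃ * x₀ + 0ℚ)))
        c₀ = x₃ + (x₀ + x₀) + x₁
        c₁ = x₀ + (x₁ + x₁) + x₂
        c₂ = x₁ + (x₂ + x₂) + x₃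
        c₃ = x₂ + (x₃ + x₃) + x₀
    in norm - - (1ℚ * forward + 0ℚ * backward)
         - ((x₀ - x₂) * (x₀ - x₂) + (x₁ - x₃) * (x₁ - x₃)) * (½ * ½)
       ≡ (c₀ * c₀ + (c₁ * c₁ + (c₂ * c₂ + (c₃ * c₃ + 0ℚ)))) * (½ * ½ * ½)
  identity = solve-∀ ℚ-ring
  excess : gap (-ᴹ cycleᴹ 1ℚ 0ℚ) x - antipodal x ≡ normSq curvature * (½ * ½ * ½)
  excess = trans (cong (λ b → normSq x - b - antipodal x)
                       (trans (bilin-neg x (cycleᴹ 1ℚ 0ℚ) x) (cong -_ (bilin-cycleᴹ 1ℚ 0ℚ x x))))
                 (identity (x 0F) (x 1F) (x 2F) (x 3F))

cycle-≈ : ∀ δ ε → 0ℚ ≤ δ → 4ℚ * δ ≤ ε → cycleᴹ (1ℚ - δ) δ ≈[ ε ] cycleᴹ 1ℚ 0ℚ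
cycle-≈ δ ε 0≤δ 4δ≤ε = ≈-intro {W̃ = cycleᴹ (1ℚ - δ) δ} {cycleᴹ 1ℚ 0ℚ} antipodal
  (≤-trans (0≤* (nonNegative⁻¹ 4ℚ) 0≤δ) 4δ≤ε) cycle-gap (cycle-skew-bound 0≤δ 4δ≤ε)

neg-cycle-≈ : ∀ δ ε → 0ℚ ≤ δ → 4ℚ * δ ≤ ε → (-ᴹ cycleᴹ (1ℚ - δ) δ) ≈[ ε ] (-ᴹ cycleᴹ 1ℚ 0ℚ)
neg-cycle-≈ δ ε 0≤δ 4δ≤ε = ≈-intro {W̃ = -ᴹ W̃} { -ᴹ W} antipodal
  (≤-trans (0≤* (nonNegative⁻¹ 4ℚ) 0≤δ) 4δ≤ε) neg-cycle-gap
  (λ x y → subst (_≤ _) (sym (∣defect∣ x y)) (cycle-skew-bound 0≤δ 4δ≤ε x y))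
  where
  W = cycleᴹ 1ℚ 0ℚ
  W̃ = cycleᴹ (1ℚ - δ) δ
  ∣defect∣ : ∀ x y → ∣ bilin x ((-ᴹ W) -ᴹ (-ᴹ W̃)) y ∣ ≡ ∣ bilin x (W -ᴹ W̃) y ∣
  ∣defect∣ x y = trans (cong ∣_∣ (trans (bilin-cong x y (λ i j → neg-sub (W i j) (W̃ i j)))
                                        (bilin-neg x (W -ᴹ W̃) y)))
                       (∣-p∣≡∣p∣ (bilin x (W -ᴹ W̃) y))
    where
    neg-sub : ∀ a b → - a - - b ≡ - (a - b)
    neg-sub = solve-∀ ℚ-ring

cycle⁴-return : ∀ a b → (cycleᴹ a b ^ᴹ 4) 0F 0F ≡
  (a * b + a * b) * ((a * b + a * b) * 1ℚ + (a * a + b * b) * 0ℚ)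
  + (a * a + b * b) * ((a * b + a * b) * 0ℚ + (a * a + b * b) * 1ℚ)
cycle⁴-return a b = trans (cycleᴹ-^-2+ a b 2 0F 0F)
  (cong₂ (λ u w → (a * b + a * b) * u + (a * a + b * b) * w)
         (cycleᴹ-^-2+ a b 0 0F 0F) (cycleᴹ-^-2+ a b 0 2F 0F))

cycle⁴-defect : ∀ δ → (cycleᴹ 1ℚ 0ℚ ^ᴹ 4) 0F 0F - (cycleᴹ (1ℚ - δ) δ ^ᴹ 4) 0F 0F ≡
  let t = (1ℚ - δ) * δ * ((1ℚ - δ) * (1ℚ - δ) + δ * δ) in t + t + t + t
cycle⁴-defect δ = trans (cong (λ r → 1ℚ - r) (cycle⁴-return (1ℚ - δ) δ)) (identity δ)
  where
  identity : ∀ δ → let s = 1ℚ - δ ; t = s * δ * (s * s + δ * δ) in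
    1ℚ - ((s * δ + s * δ) * ((s * δ + s * δ) * 1ℚ + (s * s + δ * δ) * 0ℚ)
          + (s * s + δ * δ) * ((s * δ + s * δ) * 0ℚ + (s * s + δ * δ) * 1ℚ))
    ≡ t + t + t + t
  identity = solve-∀ ℚ-ring

cycle⁴-≉ : ∀ δ c → 0ℚ < δ → 0ℚ < 1ℚ - δ → ¬ ((cycleᴹ (1ℚ - δ) δ ^ᴹ 4) ≈[ c ] (cycleᴹ 1ℚ 0ℚ ^ᴹ 4))
cycle⁴-≉ δ c 0<δ 0<s approx = <⇒≢ 0<defect (sym defect≡0)
  where
  W⁴ = cycleᴹ 1ℚ 0ℚ ^ᴹ 4
  W̃⁴ = cycleᴹ (1ℚ - δ) δ ^ᴹ 4
  defect≡0 : W⁴ 0F 0F - W̃⁴ 0F 0F ≡ 0ℚ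
  defect≡0 = trans (sym (bilin-identity 0F (W⁴ -ᴹ W̃⁴) 0F))
                   (≈⇒defect≡0 {W̃ = W̃⁴} {W⁴} {c} (identityᴹ 0F) approx refl)
  0<t : 0ℚ < (1ℚ - δ) * δ * ((1ℚ - δ) * (1ℚ - δ) + δ * δ)
  0<t = 0<* (0<* 0<s 0<δ) (+-mono-< (0<* 0<s 0<s) (0<* 0<δ 0<δ))
  0<defect : 0ℚ < W⁴ 0F 0F - W̃⁴ 0F 0F
  0<defect = subst (0ℚ <_) (sym (cycle⁴-defect δ))
                   (+-mono-< (+-mono-< (+-mono-< 0<t 0<t) 0<t) 0<t)

reverseWeight : ℕ → ℚ
reverseWeight m = (+ 1) / (ℕ.suc m ℕ.+ 1)

∃-small-reverseWeight : ∀ ε → 0ℚ < ε → ∃ λ m → 4ℚ * reverseWeight m ≤ ε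
∃-small-reverseWeight (mkℚ (+ ℕ.suc n) d-1 _) _ =
  m , toℚᵘ-cancel-≤ (ℚᵘ.≤-respˡ-≃ (ℚᵘ.≃-sym 4δ≃) (ℚᵘ.*≤* (ℤ.+≤+ 4d≤n*den)))
  where
  m = 4 ℕ.* d-1 ℕ.+ 2
  den≡4d : ℕ.suc m ℕ.+ 1 ≡ 4 ℕ.* ℕ.suc d-1
  den≡4d = denominator d-1
    where
    denominator : ∀ d → ℕ.suc (4 ℕ.* d ℕ.+ 2) ℕ.+ 1 ≡ 4 ℕ.* ℕ.suc d
    denominator = ℕ-solve-∀
  4d≤n*den : 4 ℕ.* ℕ.suc d-1 ℕ.≤ ℕ.suc n ℕ.* (1 ℕ.* (ℕ.suc m ℕ.+ 1))
  4d≤n*den = begin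
    4 ℕ.* ℕ.suc d-1              ≡⟨ den≡4d ⟨
    ℕ.suc m ℕ.+ 1               ≡⟨ ℕ.*-identityˡ _ ⟨
    1 ℕ.* (ℕ.suc m ℕ.+ 1)        ≤⟨ ℕ.m≤n*m _ (ℕ.suc n) ⟩
    ℕ.suc n ℕ.* (1 ℕ.* (ℕ.suc m ℕ.+ 1)) ∎
    where open ℕ.≤-Reasoning
  4δ≃ : toℚᵘ (4ℚ * reverseWeight m) ℚᵘ.≃ ℚᵘ.mkℚᵘ (+ 4) 0 ℚᵘ.* ℚᵘ.mkℚᵘ (+ 1) (m ℕ.+ 1)
  4δ≃ = ℚᵘ.≃-trans (toℚᵘ-homo-* 4ℚ (reverseWeight m))
                   (ℚᵘ.*-congˡ (toℚᵘ-fromℚᵘ (ℚᵘ.mkℚᵘ (+ 1) (m ℕ.+ 1))))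
∃-small-reverseWeight (mkℚ (+ 0) _ _) 0<ε with positive 0<ε
... | ()
∃-small-reverseWeight (mkℚ -[1+ _ ] _ _) 0<ε with positive 0<ε
... | ()

perturbed-cycle-properties : ∀ (W̃ W : Mat 4) δ ε → W̃ ≗ᴹ cycleᴹ (1ℚ - δ) δ → W ≗ᴹ cycleᴹ 1ℚ 0ℚ →
  0ℚ < δ → 0ℚ < 1ℚ - δ → 4ℚ * δ ≤ ε →
  (W̃ ≈[ ε ] W) × ((-ᴹ W̃) ≈[ ε ] (-ᴹ W)) × ((c : ℚ) → 0ℚ ≤ c → ¬ ((W̃ ^ᴹ 4) ≈[ c ] (W ^ᴹ 4)))
perturbed-cycle-properties W̃ W δ ε W̃≗ W≗ 0<δ 0<1-δ 4δ≤ε =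
  -- ε must be given: it cannot be recovered from _≈[_]_, which unfolds to a Π-type.
  ≈-resp {ε = ε} (≗ᴹ-sym W̃≗) (≗ᴹ-sym W≗) (cycle-≈ δ ε (<⇒≤ 0<δ) 4δ≤ε) ,
  ≈-resp {ε = ε} (-ᴹ-cong (≗ᴹ-sym W̃≗)) (-ᴹ-cong (≗ᴹ-sym W≗)) (neg-cycle-≈ δ ε (<⇒≤ 0<δ) 4δ≤ε) ,
  λ c _ → cycle⁴-≉ δ c 0<δ 0<1-δ ∘ ≈-resp {ε = c} (^ᴹ-cong W̃≗ 4) (^ᴹ-cong W≗ 4)

proposition4p3 : (ε : ℚ) → 0ℚ < ε → ε < 1ℚ →
    Σ ℕ λ n → Σ (Adj n) λ Ã → Σ (Adj n) λ A →
    Σ ((j : Fin n) → NonZero (outdeg Ã j)) λ nzÃ →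
    Σ ((j : Fin n) → NonZero (outdeg A j)) λ nzA →
      IsRegular Ã × IsRegular A ×
      (transition Ã nzÃ ≈[ ε ] transition A nzA) ×
      ((-ᴹ transition Ã nzÃ) ≈[ ε ] (-ᴹ transition A nzA)) ×
      ((c : ℚ) → 0ℚ ≤ c →
        ¬ ((transition Ã nzÃ ^ᴹ 4) ≈[ c ] (transition A nzA ^ᴹ 4)))
proposition4p3 ε 0<ε _ =
  4 , Ã , A , nzÃ , nzA , cycleAdj-regular (ℕ.suc m) 1 , cycleAdj-regular 1 0 ,
  perturbed-cycle-properties (transition Ã nzÃ) (transition A nzA) (reverseWeight m) ε
                             W̃≗ W≗ 0<δ 0<1-δ 4δ≤ε
  where
  m : ℕ
  m = proj₁ (∃-small-reverseWeight ε 0<ε)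
  4δ≤ε : 4ℚ * reverseWeight m ≤ ε
  4δ≤ε = proj₂ (∃-small-reverseWeight ε 0<ε)
  Ã A : Adj 4
  Ã = cycleAdj (ℕ.suc m) 1
  A = cycleAdj 1 0
  nzÃ : ∀ j → NonZero (outdeg Ã j)
  nzÃ = cycleAdj-nonZero (ℕ.suc m) 1
  nzA : ∀ j → NonZero (outdeg A j)
  nzA = cycleAdj-nonZero 1 0
  forwardWeight≡ : (+ ℕ.suc m) / (ℕ.suc m ℕ.+ 1) ≡ 1ℚ - reverseWeight m
  forwardWeight≡ = /-complement (ℕ.suc m) 1 (m ℕ.+ 1) refl
  W̃≗ : transition Ã nzÃ ≗ᴹ cycleᴹ (1ℚ - reverseWeight m) (reverseWeight m)
  W̃≗ i j = trans (transition-cycleAdj (ℕ.suc m) 1 nzÃ i j)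
                 (cong (λ s → cycleᴹ s (reverseWeight m) i j) forwardWeight≡)
  W≗ : transition A nzA ≗ᴹ cycleᴹ 1ℚ 0ℚ
  W≗ = transition-cycleAdj 1 0 nzA
  0<δ : 0ℚ < reverseWeight m
  0<δ = positive⁻¹ (reverseWeight m) {{normalize-pos 1 (ℕ.suc m ℕ.+ 1)}}
  0<1-δ : 0ℚ < 1ℚ - reverseWeight m
  0<1-δ = subst (0ℚ <_) forwardWeight≡ (positive⁻¹ _ {{normalize-pos (ℕ.suc m) (ℕ.suc m ℕ.+ 1)}})
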